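{- Every reducible DAG admits a leaf induced path partition. Consequently, every orchard is forest-based.
   Context: For a DAG $N$: a root is a vertex of indegree $0$, a leaf a vertex of outdegree $0$ ($L(N)$ the leaf set), a reticulation a non-leaf vertex of indegree at least $2$, a subdivision vertex one of indegree $1$ and outdegree $1$; suppressing a subdivision vertex $v$ with in-neighbor $u$ and out-neighbor $w$ means deleting $v$ and adding the arc $(u,w)$. Let $N$ be a DAG with no subdivision vertex in which every leaf has indegree $1$ ($N$ need not be connected, binary or single-rooted). A cherry of $N$ is a pair $(x,y)$ of distinct leaves whose in-neighbors $x',y'$ satisfy either $x'=y'$ (standard cherry), or $y'$ is a reticulation and $(x',y')\in A(N)$ (reticulated cherry). Picking a standard cherry $(x,y)$ removes $y$ and its incident arc and suppresses a resulting subdivision vertex if any; picking a reticulated cherry removes the arc $(x',y')$ and suppresses resulting subdivision vertices. A DAG is reduced if each connected component has exactly one arc, from a root to a leaf. A DAG is reducible if some sequence of cherry-picking operations transforms it into a reduced DAG. A network is a connected DAG with at least two vertices in which every root has outdegree at least $2$, every leaf has indegree $1$, every reticulation has outdegree $1$, and there is no subdivision vertex; an orchard is a network that is reducible. A directed path $v_1,\dots,v_k$ is induced if there is no arc $(v_i,v_j)$ with $i\in[k-2]$, $j\in[k]\setminus\{i,i+1\}$; a leaf induced path partition is a partition of $V(N)$ into induced directed paths each ending at a leaf. A tree is a connected DAG with one root and no vertex of indegree $\ge 2$; a forest is a DAG whose components are trees; $N=(V,A)$ is forest-based if there exists $A'\subseteq A$ with $F'=(V,A')$ a forest with leaf set $L(N)$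 such that every arc of $A\setminus A'$ has endpoints in different trees of $F'$. -}

module Defs where

open import Data.Nat using (ℕ; zero; suc; _≤_)
open import Data.Bool using (Bool; true; false; _∧_; not; if_then_else_)
open import Data.Fin using (Fin; zero; suc; toℕ; _≟_)
open import Data.List using (List; []; _∷_; length; lookup; concat; _∷ʳ_)
open import Data.List.Relation.Unary.All using (All)
open import Data.List.Relation.Unary.Linked using (Linked)
open import Data.List.Relation.Unary.Unique.Propositional using (Unique)
open import Data.List.Membership.Propositional using (_∈_)
open import Data.Product using (Σ; ∃; _×_; _,_)
open import Relation.Nullary using (¬_)
open import Relation.Nullary.Decidable using (⌊_⌋)
open import Relation.Binary.PropositionalEquality using (_≡_; _≢_)
open import Relation.Binary.Construct.Closure.Transitive using (TransClosure)
open import Relation.Binary.Construct.Closure.Symmetric using (SymClosure)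
open import Relation.Binary.Construct.Closure.ReflexiveTransitive using (Star)

-- A graph lives on the vertex slots Fin n; the vertex set V is the set of
-- slots marked alive.  This lets cherry-picking delete vertices without
-- re-indexing.

record Graph (n : ℕ) : Set where
  field
    alive : Fin n → Bool
    arc   : Fin n → Fin n → Bool
open Graph public

module _ {n : ℕ} (G : Graph n) where

  V : Fin n → Set
  V v = alive G v ≡ true

  Arc : Fin n → Fin n → Set
  Arc u v = arc G u v ≡ true

count : ∀ {n} → (Fin n → Bool) → ℕ
count {zero}  f = 0
count {suc n} f = (if f zero then 1 else 0) Data.Nat.+ count (λ i → f (suc i))

module _ {n : ℕ} (G : Graph n) where

  indeg : Fin n → ℕ
  indeg v = count (λ u → arc G u v)

  outdeg : Fin n → ℕ
  outdeg v = count (λ w → arc G v w)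

  IsRoot : Fin n → Set
  IsRoot v = V G v × indeg v ≡ 0

  IsLeaf : Fin n → Set
  IsLeaf v = V G v × outdeg v ≡ 0

  IsReticulation : Fin n → Set
  IsReticulation v = V G v × outdeg v ≢ 0 × 2 ≤ indeg v

  IsSubdivision : Fin n → Set
  IsSubdivision v = V G v × indeg v ≡ 1 × outdeg v ≡ 1

  IsDAG : Set
  IsDAG = (∀ u v → Arc G u v → V G u × V G v)
        × (∀ v → ¬ TransClosure (Arc G) v v)

  NoSubdivision : Set
  NoSubdivision = ∀ v → ¬ IsSubdivision v

  LeavesIndeg1 : Set
  LeavesIndeg1 = ∀ v → IsLeaf v → indeg v ≡ 1

  Conn : Fin n → Fin n → Set
  Conn = Star (SymClosure (Arc G))

  -- each connected component has exactly one arc, and it goes from a root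
  -- to a leaf
  IsReduced : Set
  IsReduced = ∀ v → V G v →
    Σ (Fin n) λ a → Σ (Fin n) λ b →
      Arc G a b × Conn v a × IsRoot a × IsLeaf b
      × (∀ c d → Arc G c d → Conn v c → c ≡ a × d ≡ b)

_==_ : ∀ {n} → Fin n → Fin n → Bool
i == j = ⌊ i ≟ j ⌋

removeLeaf : ∀ {n} → Graph n → Fin n → Graph n
removeLeaf G y = record
  { alive = λ v → alive G v ∧ not (v == y)
  ; arc   = λ u v → arc G u v ∧ not (v == y) }

removeArc : ∀ {n} → Graph n → Fin n → Fin n → Graph n
removeArc G p q = record
  { alive = alive G
  ; arc   = λ a b → arc G a b ∧ not ((a == p) ∧ (b == q)) }

suppress : ∀ {n} → Graph n → Fin n → Fin n → Fin n → Graph n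
suppress G u v w = record
  { alive = λ x → alive G x ∧ not (x == v)
  ; arc   = λ a b → if (a == u) ∧ (b == w) then true
                    else (arc G a b ∧ (not (a == v) ∧ not (b == v))) }

data Suppressed {n : ℕ} (G : Graph n) (v : Fin n) : Graph n → Set where
  not-subdiv : ¬ IsSubdivision G v → Suppressed G v G
  subdiv     : (u w : Fin n) → IsSubdivision G v → Arc G u v → Arc G v w →
               Suppressed G v (suppress G u v w)

-- (x , y) is a cherry: distinct leaves with in-neighbours x' = p and y' = q
-- (leaves have indegree 1, so in-neighbours are unique)
data PickCherry {n : ℕ} (G : Graph n) : Graph n → Set where
  standard : (x y p : Fin n) → IsLeaf G x → IsLeaf G y → x ≢ y →
             Arc G p x → Arc G p y →
             ∀ {G'} → Suppressed (removeLeaf G y) p G' → PickCherry G G'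
  reticulated : (x y p q : Fin n) → IsLeaf G x → IsLeaf G y → x ≢ y →
                Arc G p x → Arc G q y → IsReticulation G q → Arc G p q →
                ∀ {G₁ G₂} → Suppressed (removeArc G p q) p G₁ →
                Suppressed G₁ q G₂ → PickCherry G G₂

Reducible : ∀ {n} → Graph n → Set
Reducible G = Σ _ λ G' → Star PickCherry G G' × IsReduced G'

module _ {n : ℕ} (G : Graph n) where

  -- v₁,…,vₖ is induced: no arc (vᵢ , vⱼ) with i ∈ [k-2], j ∉ {i , i+1}
  -- (0-based indices here: toℕ i + 3 ≤ k)
  IsInduced : List (Fin n) → Set
  IsInduced p = ∀ (i j : Fin (length p)) →
    suc (suc (suc (toℕ i))) ≤ length p →
    toℕ j ≢ toℕ i → toℕ j ≢ suc (toℕ i) →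
    ¬ Arc G (lookup p i) (lookup p j)

  EndsAtLeaf : List (Fin n) → Set
  EndsAtLeaf p = Σ (List (Fin n)) λ ps → Σ (Fin n) λ l → p ≡ ps ∷ʳ l × IsLeaf G l

  IsLeafInducedPath : List (Fin n) → Set
  IsLeafInducedPath p = Linked (Arc G) p × IsInduced p × EndsAtLeaf p

  IsLeafInducedPathPartition : List (List (Fin n)) → Set
  IsLeafInducedPathPartition P =
    All IsLeafInducedPath P
    × Unique (concat P)
    × (∀ v → v ∈ concat P → V G v)
    × (∀ v → V G v → v ∈ concat P)

  HasLeafInducedPathPartition : Set
  HasLeafInducedPathPartition = Σ _ IsLeafInducedPathPartition

module _ {n : ℕ} (G : Graph n) where

  IsNetwork : Set
  IsNetwork = IsDAG G
    × (∀ u v → V G u → V G v → Conn G u v)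
    × (Σ (Fin n) λ u → Σ (Fin n) λ v → V G u × V G v × u ≢ v)
    × (∀ v → IsRoot G v → 2 ≤ outdeg G v)
    × LeavesIndeg1 G
    × (∀ v → IsReticulation G v → outdeg G v ≡ 1)
    × NoSubdivision G

  IsOrchard : Set
  IsOrchard = IsNetwork × Reducible G

  IsForest : Set
  IsForest = IsDAG G
    × (∀ v → V G v → ¬ (2 ≤ indeg G v))
    × (∀ v → V G v → Σ (Fin n) λ r → IsRoot G r × Conn G v r
                       × (∀ r' → IsRoot G r' → Conn G v r' → r' ≡ r))

spanning : ∀ {n} → Graph n → (Fin n → Fin n → Bool) → Graph n
spanning G a' = record { alive = alive G ; arc = a' }

IsForestBased : ∀ {n} → Graph n → Set
IsForestBased {n} G = Σ (Fin n → Fin n → Bool) λ a' →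
  let F = spanning G a' in
    (∀ u v → Arc F u v → Arc G u v)
  × IsForest F
  × (∀ v → (IsLeaf F v → IsLeaf G v) × (IsLeaf G v → IsLeaf F v))
  × (∀ u v → Arc G u v → ¬ Arc F u v → ¬ Conn F u v)

module Submission where

-- Work backwards along a cherry-picking sequence, maintaining a partition of the vertices into
-- directed paths that end at leaves and are chordless: every arc between two vertices of a path
-- joins consecutive ones. A reduced DAG is partitioned by its arcs. Undoing the removal of a
-- leaf y adds the one-vertex path y; undoing a suppression puts the suppressed vertex in front
-- of its child. Undoing the removal of an arc (p, q), where p is the parent of the leaf x, keeps
-- the partition if x follows p on its path, and otherwise cuts the path through p after p and
-- appends x. The arc (p, q) never becomes a chord, since q would then precede p on a path and
-- close a cycle. The consecutive pairs on the paths form a spanning forest whose trees are the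
-- paths and whose leaves are those of the DAG, so every other arc joins two different trees.

open import Defs
open import Data.Nat using (ℕ; zero; suc; pred; _≤_; s≤s)
open import Data.Nat.Properties using (n>0⇒n≢0)
open import Data.Bool using (Bool; true; false; _∧_; not) renaming (_≟_ to _≟ᵇ_)
open import Data.Bool.Properties using (¬-not)
open import Data.Fin using (Fin; zero; suc; toℕ; _≟_)
open import Data.Fin.Properties using (suc-injective; 0≢1+n)
open import Data.List
  using (List; []; _∷_; _++_; _∷ʳ_; concat; map; filter; length; lookup; allFin; cartesianProduct;
         initLast; _∷ʳ′_)
open import Data.List.Properties using (++-assoc; ++-identityʳ; concat-++; ∷ʳ-injectiveʳ)
open import Data.List.Relation.Unary.All as All using ()
open import Data.List.Relation.Unary.All.Properties using (¬Any⇒All¬)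
open import Data.List.Relation.Unary.AllPairs using ([]; _∷_)
open import Data.List.Relation.Unary.Any using (any?; here; there)
open import Data.List.Relation.Unary.Linked as Linked using (Linked; []; [-]; _∷_)
open import Data.List.Relation.Unary.Unique.Propositional using (Unique)
open import Data.List.Relation.Unary.Unique.Propositional.Properties
  using (Unique[x∷xs]⇒x∉xs; ++⁺; filter⁺; cartesianProduct⁺; allFin⁺)
open import Data.List.Membership.Propositional using (_∈_; _∉_; find; lose)
open import Data.List.Membership.Propositional.Properties
  using (∈-++⁺ˡ; ∈-++⁺ʳ; ∈-++⁻; ∈-∃++; ∈-concat⁺′; ∈-concat⁻′; ∈-map⁺; ∈-map⁻;
         ∈-filter⁺; ∈-filter⁻; ∈-allFin; ∈-cartesianProduct⁺; ∈-lookup)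
open import Data.List.Relation.Binary.Disjoint.Propositional using (Disjoint)
open import Data.List.Relation.Binary.Permutation.Propositional
  using (_↭_; ↭-sym; prep; ↭⇒↭ₛ; module PermutationReasoning)
open import Data.List.Relation.Binary.Permutation.Propositional.Properties using (∈-resp-↭; shift; shifts)
import Data.List.Relation.Binary.Permutation.Setoid.Properties as Setoid↭
open import Data.Product using (Σ; ∃; ∃-syntax; _×_; _,_; proj₁; proj₂; map₂)
open import Data.Sum using (_⊎_; inj₁; inj₂; [_,_]′) renaming (map to ⊎-map)
open import Data.Empty using (⊥-elim)
open import Function using (_∘_; id)
open import Relation.Nullary using (¬_; Dec; yes; no; _×-dec_)
open import Relation.Nullary.Decidable using (isYes)
open import Relation.Binary.Definitions using (DecidableEquality)
open import Relation.Binary.PropositionalEquality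
  using (_≡_; _≢_; ≢-sym; refl; sym; trans; cong; subst; setoid)
open import Relation.Binary.Construct.Closure.Transitive as Plus using (TransClosure; [_]; _∷_)
open import Relation.Binary.Construct.Closure.ReflexiveTransitive using (Star; ε; _◅_; _◅◅_)
open import Relation.Binary.Construct.Closure.Symmetric using (SymClosure; fwd; bwd)

private
  variable
    n : ℕ
    A : Set

isYes⇒ : (d : Dec A) → isYes d ≡ true → A
isYes⇒ (yes a) _ = a

⇒isYes : (d : Dec A) → A → isYes d ≡ true
⇒isYes (yes _) _ = refl
⇒isYes (no ¬a) a = ⊥-elim (¬a a)

∧-true⁻ : ∀ {a b} → a ∧ b ≡ true → a ≡ true × b ≡ true
∧-true⁻ {true} {true} _ = refl , refl

∧-true⁺ : ∀ {a b} → a ≡ true → b ≡ true → a ∧ b ≡ true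
∧-true⁺ refl refl = refl

count≡0⇒false : (f : Fin n → Bool) → count f ≡ 0 → ∀ i → f i ≡ false
count≡0⇒false {suc n} f c i with f zero in f0
count≡0⇒false f c zero    | false = f0
count≡0⇒false f c (suc i) | false = count≡0⇒false (λ j → f (suc j)) c i

false⇒count≡0 : (f : Fin n → Bool) → (∀ i → f i ≡ false) → count f ≡ 0
false⇒count≡0 {zero}  f all-false = refl
false⇒count≡0 {suc n} f all-false rewrite all-false zero =
  false⇒count≡0 (λ j → f (suc j)) (λ j → all-false (suc j))

true⇒count≢0 : (f : Fin n → Bool) (i : Fin n) → f i ≡ true → count f ≢ 0
true⇒count≢0 f i fi c with () ← trans (sym fi) (count≡0⇒false f c i)

count≢0⇒true : (f : Fin n → Bool) → count f ≢ 0 → ∃[ i ] f i ≡ true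
count≢0⇒true {zero}  f c≢0 = ⊥-elim (c≢0 refl)
count≢0⇒true {suc n} f c≢0 with f zero in f0
... | true  = zero , f0
... | false with i , fi ← count≢0⇒true (λ j → f (suc j)) c≢0 = suc i , fi

count≡1⇒unique : (f : Fin n → Bool) → count f ≡ 1 →
                 ∃[ i ] f i ≡ true × (∀ j → f j ≡ true → j ≡ i)
count≡1⇒unique {suc n} f c with f zero in f0
... | true = zero , f0 , only-zero
  where
  only-zero : ∀ j → f j ≡ true → j ≡ zero
  only-zero zero    _  = refl
  only-zero (suc j) fj with () ← trans (sym fj) (count≡0⇒false (λ k → f (suc k)) (cong pred c) j)
... | false with i , fi , only-i ← count≡1⇒unique (λ j → f (suc j)) c = suc i , fi , only-suc-i
  where
  only-suc-i : ∀ j → f j ≡ true → j ≡ suc i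
  only-suc-i zero    fj with () ← trans (sym fj) f0
  only-suc-i (suc j) fj = cong suc (only-i j fj)

unique⇒count≡1 : (f : Fin n → Bool) (i : Fin n) → f i ≡ true → (∀ j → f j ≡ true → j ≡ i) →
                 count f ≡ 1
unique⇒count≡1 {suc n} f zero fi only-i rewrite fi =
  cong suc (false⇒count≡0 (λ j → f (suc j)) λ j → ¬-not λ fj → 0≢1+n (sym (only-i (suc j) fj)))
unique⇒count≡1 {suc n} f (suc i) fi only-i with f zero in f0
... | true  with () ← only-i zero f0
... | false = unique⇒count≡1 (λ j → f (suc j)) i fi (λ j fj → suc-injective (only-i (suc j) fj))

atMostOne⇒count≱2 : (f : Fin n → Bool) → (∀ i j → f i ≡ true → f j ≡ true → i ≡ j) →
                    ¬ 2 ≤ count f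
atMostOne⇒count≱2 {suc n} f at-most-one 2≤c with f zero in f0 | 2≤c
... | true | s≤s 1≤c
  with j , fj ← count≢0⇒true (λ k → f (suc k)) (n>0⇒n≢0 1≤c)
  with () ← at-most-one zero (suc j) f0 fj
... | false | 2≤c′ =
  atMostOne⇒count≱2 (λ k → f (suc k))
    (λ i j fi fj → suc-injective (at-most-one (suc i) (suc j) fi fj)) 2≤c′

module _ {n : ℕ} (G : Graph n) where

  SoleParent : Fin n → Fin n → Set
  SoleParent z l = Arc G z l × (∀ a → Arc G a l → a ≡ z)

  SoleChild : Fin n → Fin n → Set
  SoleChild v w = Arc G v w × (∀ b → Arc G v b → b ≡ w)

  Acyclic : Set
  Acyclic = ∀ v → ¬ TransClosure (Arc G) v v

  DAGWithLeavesIndeg1 : Set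
  DAGWithLeavesIndeg1 = IsDAG G × LeavesIndeg1 G

module _ {n : ℕ} (G : Graph n) where

  leaf⇒noArc : ∀ {l} → IsLeaf G l → ∀ b → ¬ Arc G l b
  leaf⇒noArc {l} (_ , out0) b lb with () ← trans (sym lb) (count≡0⇒false (arc G l) out0 b)

  noArc⇒leaf : ∀ {l} → V G l → (∀ b → ¬ Arc G l b) → IsLeaf G l
  noArc⇒leaf {l} vl no-arc = vl , false⇒count≡0 (arc G l) (λ b → ¬-not (no-arc b))

  leaf≢tail : ∀ {l a b} → IsLeaf G l → Arc G a b → l ≢ a
  leaf≢tail lf ab refl = leaf⇒noArc lf _ ab

  indeg≡1⇒soleParent : ∀ {z l} → indeg G l ≡ 1 → Arc G z l → SoleParent G z l
  indeg≡1⇒soleParent {z} {l} d1 zl with _ , _ , only ← count≡1⇒unique (λ a → arc G a l) d1 =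
    zl , λ a al → trans (only a al) (sym (only z zl))

  indeg≡1⇒∃soleParent : ∀ {l} → indeg G l ≡ 1 → ∃[ z ] SoleParent G z l
  indeg≡1⇒∃soleParent {l} d1 = count≡1⇒unique (λ a → arc G a l) d1

  soleParent⇒indeg≡1 : ∀ {z l} → SoleParent G z l → indeg G l ≡ 1
  soleParent⇒indeg≡1 {z} {l} (zl , only) = unique⇒count≡1 (λ a → arc G a l) z zl only

  outdeg≡1⇒soleChild : ∀ {v w} → outdeg G v ≡ 1 → Arc G v w → SoleChild G v w
  outdeg≡1⇒soleChild {v} {w} d1 vw with _ , _ , only ← count≡1⇒unique (arc G v) d1 =
    vw , λ b vb → trans (only b vb) (sym (only w vw))

  leaf-soleParent : LeavesIndeg1 G → ∀ {z l} → IsLeaf G l → Arc G z l → SoleParent G z l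
  leaf-soleParent leaves1 {l = l} lf = indeg≡1⇒soleParent (leaves1 l lf)

  acyclic⇒irreflexive : Acyclic G → ∀ {a b} → Arc G a b → a ≢ b
  acyclic⇒irreflexive acyclic ab refl = acyclic _ [ ab ]

acyclic-⊆⁺ : (G G′ : Graph n) → (∀ {a b} → Arc G′ a b → TransClosure (Arc G) a b) →
             Acyclic G → Acyclic G′
acyclic-⊆⁺ G G′ G′⊆G⁺ acyclic v cycle = acyclic v (lift cycle)
  where
  lift : ∀ {a b} → TransClosure (Arc G′) a b → TransClosure (Arc G) a b
  lift [ ab ]   = G′⊆G⁺ ab
  lift (ab ∷ p) = G′⊆G⁺ ab Plus.++ lift p

-- The elementary modifications of a graph

module _ {i j : Fin n} where

  ==⇒≡ : (i == j) ≡ true → i ≡ j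
  ==⇒≡ = isYes⇒ (i ≟ j)

  ≡⇒== : i ≡ j → (i == j) ≡ true
  ≡⇒== = ⇒isYes (i ≟ j)

  not-==⇒≢ : not (i == j) ≡ true → i ≢ j
  not-==⇒≢ ¬i==j i≡j with () ← trans (sym ¬i==j) (cong not (≡⇒== i≡j))

  ≢⇒not-== : i ≢ j → not (i == j) ≡ true
  ≢⇒not-== i≢j with i ≟ j
  ... | yes i≡j = ⊥-elim (i≢j i≡j)
  ... | no _    = refl

module _ {a b c d : Fin n} where

  ==∧==⇒ : (a == c) ∧ (b == d) ≡ true → a ≡ c × b ≡ d
  ==∧==⇒ eq with a==c , b==d ← ∧-true⁻ eq = ==⇒≡ a==c , ==⇒≡ b==d

module _ (G : Graph n) (y : Fin n) where

  removeLeaf-alive⁻ : ∀ {a} → V (removeLeaf G y) a → V G a × a ≢ y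
  removeLeaf-alive⁻ va with va′ , a≢y ← ∧-true⁻ va = va′ , not-==⇒≢ a≢y

  removeLeaf-alive⁺ : ∀ {a} → V G a → a ≢ y → V (removeLeaf G y) a
  removeLeaf-alive⁺ va a≢y = ∧-true⁺ va (≢⇒not-== a≢y)

  removeLeaf-arc⁻ : ∀ {a b} → Arc (removeLeaf G y) a b → Arc G a b × b ≢ y
  removeLeaf-arc⁻ ab with ab′ , b≢y ← ∧-true⁻ ab = ab′ , not-==⇒≢ b≢y

  removeLeaf-arc⁺ : ∀ {a b} → Arc G a b → b ≢ y → Arc (removeLeaf G y) a b
  removeLeaf-arc⁺ ab b≢y = ∧-true⁺ ab (≢⇒not-== b≢y)

module _ (G : Graph n) (p q : Fin n) where

  removeArc-arc⁻ : ∀ {a b} → Arc (removeArc G p q) a b → Arc G a b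
  removeArc-arc⁻ ab = proj₁ (∧-true⁻ ab)

  removeArc-arc⁺ : ∀ {a b} → Arc G a b → ¬ (a ≡ p × b ≡ q) → Arc (removeArc G p q) a b
  removeArc-arc⁺ {a} {b} ab ≢pq with (a == p) ∧ (b == q) in pq
  ... | true  = ⊥-elim (≢pq (==∧==⇒ pq))
  ... | false = ∧-true⁺ ab refl

  removeArc-arc-split : ∀ {a b} → Arc G a b → Arc (removeArc G p q) a b ⊎ (a ≡ p × b ≡ q)
  removeArc-arc-split {a} {b} ab with (a ≟ p) ×-dec (b ≟ q)
  ... | yes a≡p×b≡q = inj₂ a≡p×b≡q
  ... | no  ≢pq     = inj₁ (removeArc-arc⁺ ab ≢pq)

module _ (G : Graph n) (u v w : Fin n) where

  suppress-alive⁻ : ∀ {a} → V (suppress G u v w) a → V G a × a ≢ v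
  suppress-alive⁻ va with va′ , a≢v ← ∧-true⁻ va = va′ , not-==⇒≢ a≢v

  suppress-alive⁺ : ∀ {a} → V G a → a ≢ v → V (suppress G u v w) a
  suppress-alive⁺ va a≢v = ∧-true⁺ va (≢⇒not-== a≢v)

  suppress-arc⁻ : ∀ {a b} → Arc (suppress G u v w) a b →
                  (a ≡ u × b ≡ w) ⊎ (Arc G a b × a ≢ v × b ≢ v)
  suppress-arc⁻ {a} {b} ab with (a == u) ∧ (b == w) in uw
  ... | true  = inj₁ (==∧==⇒ uw)
  ... | false with ab′ , a≢v∧b≢v ← ∧-true⁻ ab with a≢v , b≢v ← ∧-true⁻ a≢v∧b≢v =
    inj₂ (ab′ , not-==⇒≢ a≢v , not-==⇒≢ b≢v)

  suppress-arc-bypass : Arc (suppress G u v w) u w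
  suppress-arc-bypass rewrite ≡⇒== {i = u} refl | ≡⇒== {i = w} refl = refl

  suppress-arc⁺ : ∀ {a b} → Arc G a b → a ≢ v → b ≢ v → Arc (suppress G u v w) a b
  suppress-arc⁺ {a} {b} ab a≢v b≢v with (a == u) ∧ (b == w)
  ... | true  = refl
  ... | false = ∧-true⁺ ab (∧-true⁺ (≢⇒not-== a≢v) (≢⇒not-== b≢v))

module _ (G : Graph n) {v : Fin n} (sv : IsSubdivision G v) where

  subdivision-soleParent : ∀ {u} → Arc G u v → SoleParent G u v
  subdivision-soleParent = indeg≡1⇒soleParent G (proj₁ (proj₂ sv))

  subdivision-soleChild : ∀ {w} → Arc G v w → SoleChild G v w
  subdivision-soleChild = outdeg≡1⇒soleChild G (proj₂ (proj₂ sv))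

module _ {G : Graph n} {v : Fin n} where

  Suppressed-arc⁻ : ∀ {G′ a b} → Suppressed G v G′ → Arc G′ a b → Arc G a b ⊎ (Arc G a v × Arc G v b)
  Suppressed-arc⁻ (not-subdiv _) ab = inj₁ ab
  Suppressed-arc⁻ (subdiv u w _ uv vw) ab with suppress-arc⁻ G u v w ab
  ... | inj₁ (refl , refl) = inj₂ (uv , vw)
  ... | inj₂ (ab′ , _)     = inj₁ ab′

  Suppressed-arc⁺ : ∀ {G′ a b} → Suppressed G v G′ → Arc G a b → a ≢ v → b ≢ v → Arc G′ a b
  Suppressed-arc⁺ (not-subdiv _)     ab _   _   = ab
  Suppressed-arc⁺ (subdiv u w _ _ _) ab a≢v b≢v = suppress-arc⁺ G u v w ab a≢v b≢v

  Suppressed-arc⇒path : ∀ {G′ a b} → Suppressed G v G′ → Arc G′ a b → TransClosure (Arc G) a b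
  Suppressed-arc⇒path s ab with Suppressed-arc⁻ s ab
  ... | inj₁ ab′       = [ ab′ ]
  ... | inj₂ (av , vb) = av ∷ [ vb ]

  Suppressed-leaf⁻ : ∀ {G′ l} → Suppressed G v G′ → IsLeaf G′ l → IsLeaf G l
  Suppressed-leaf⁻ (not-subdiv _) lf = lf
  Suppressed-leaf⁻ {l = l} (subdiv u w sv uv _) lf@(vl , _) =
    noArc⇒leaf G (proj₁ (suppress-alive⁻ G u v w vl)) no-arc
    where
    no-arc : ∀ b → ¬ Arc G l b
    no-arc b lb with b ≟ v
    ... | no b≢v =
      leaf⇒noArc (suppress G u v w) lf b (suppress-arc⁺ G u v w lb (proj₂ (suppress-alive⁻ G u v w vl)) b≢v)
    ... | yes refl with refl ← proj₂ (subdivision-soleParent G sv uv) l lb =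
      leaf⇒noArc (suppress G u v w) lf w (suppress-arc-bypass G u v w)

Suppressed-soleParent : {G G′ : Graph n} {v z l : Fin n} → Suppressed G v G′ →
                        SoleParent G z l → z ≢ v → l ≢ v → SoleParent G′ z l
Suppressed-soleParent {G′ = G′} {v} {z} {l} s (zl , only-z) z≢v l≢v =
  Suppressed-arc⁺ s zl z≢v l≢v , only-z′
  where
  only-z′ : ∀ a → Arc G′ a l → a ≡ z
  only-z′ a al with Suppressed-arc⁻ s al
  ... | inj₁ al′       = only-z a al′
  ... | inj₂ (_ , vl)  = ⊥-elim (z≢v (sym (only-z v vl)))

module _ (G : Graph n) where

  removeLeaf-leaf⁻ : ∀ {p x y l} → SoleParent G p y → Arc G p x → x ≢ y →
                     IsLeaf (removeLeaf G y) l → IsLeaf G l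
  removeLeaf-leaf⁻ {p} {x} {y} {l} (_ , only-p) px x≢y lf@(vl , _) =
    noArc⇒leaf G (proj₁ (removeLeaf-alive⁻ G y vl)) no-arc
    where
    no-arc : ∀ b → ¬ Arc G l b
    no-arc b lb with b ≟ y
    ... | no b≢y = leaf⇒noArc (removeLeaf G y) lf b (removeLeaf-arc⁺ G y lb b≢y)
    ... | yes refl with refl ← only-p l lb = leaf⇒noArc (removeLeaf G y) lf x (removeLeaf-arc⁺ G y px x≢y)

  removeArc-leaf⁻ : ∀ {p q x l} → Arc G p x → x ≢ q → IsLeaf (removeArc G p q) l → IsLeaf G l
  removeArc-leaf⁻ {p} {q} {x} {l} px x≢q lf@(vl , _) = noArc⇒leaf G vl no-arc
    where
    no-arc : ∀ b → ¬ Arc G l b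
    no-arc b lb with removeArc-arc-split G p q lb
    ... | inj₁ lb₀           = leaf⇒noArc (removeArc G p q) lf b lb₀
    ... | inj₂ (refl , refl) =
      leaf⇒noArc (removeArc G p q) lf x (removeArc-arc⁺ G p q px λ (_ , x≡q) → x≢q x≡q)

-- Cherry picking preserves DAGs whose leaves have indegree one

soleParent-⊆ : (G G′ : Graph n) → (∀ {a b} → Arc G′ a b → Arc G a b) →
               ∀ {z l} → SoleParent G z l → Arc G′ z l → SoleParent G′ z l
soleParent-⊆ _ _ G′⊆G (_ , only-z) zl = zl , λ a al → only-z a (G′⊆G al)

LeavesIndeg1-transfer : (G G′ : Graph n) → (∀ {l} → IsLeaf G′ l → IsLeaf G l) →
                        (∀ {z l} → IsLeaf G′ l → SoleParent G z l → ∃[ z′ ] SoleParent G′ z′ l) →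
                        LeavesIndeg1 G → LeavesIndeg1 G′
LeavesIndeg1-transfer G G′ leaf⁻ parent′ leaves1 l lf =
  soleParent⇒indeg≡1 G′ (proj₂ (parent′ lf (proj₂ (indeg≡1⇒∃soleParent G (leaves1 l (leaf⁻ lf))))))

module _ (G : Graph n) (dag₁ : DAGWithLeavesIndeg1 G) where

  private
    arcs-alive = proj₁ (proj₁ dag₁)
    acyclic    = proj₂ (proj₁ dag₁)
    leaves1    = proj₂ dag₁

  removeLeaf-preserves : ∀ {p x y} → IsLeaf G y → Arc G p y → Arc G p x → x ≢ y →
                         DAGWithLeavesIndeg1 (removeLeaf G y)
  removeLeaf-preserves {p} {x} {y} ly py px x≢y =
    (arcs-alive′ , acyclic-⊆⁺ G G′ (λ ab → [ G′⊆G ab ]) acyclic) ,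
    LeavesIndeg1-transfer G G′ (removeLeaf-leaf⁻ G (leaf-soleParent G leaves1 ly py) px x≢y) parent′ leaves1
    where
    G′ = removeLeaf G y
    G′⊆G : ∀ {a b} → Arc G′ a b → Arc G a b
    G′⊆G ab = proj₁ (removeLeaf-arc⁻ G y ab)
    arcs-alive′ : ∀ a b → Arc G′ a b → V G′ a × V G′ b
    arcs-alive′ a b ab with ab′ , b≢y ← removeLeaf-arc⁻ G y ab with va , vb ← arcs-alive a b ab′ =
      removeLeaf-alive⁺ G y va (≢-sym (leaf≢tail G ly ab′)) , removeLeaf-alive⁺ G y vb b≢y
    parent′ : ∀ {z l} → IsLeaf G′ l → SoleParent G z l → ∃[ z′ ] SoleParent G′ z′ l
    parent′ (vl , _) zl =
      _ , soleParent-⊆ G G′ G′⊆G zl (removeLeaf-arc⁺ G y (proj₁ zl) (proj₂ (removeLeaf-alive⁻ G y vl)))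

  removeArc-preserves : ∀ {p q x y} → Arc G p q → Arc G p x → x ≢ q → Arc G q y →
                        DAGWithLeavesIndeg1 (removeArc G p q)
  removeArc-preserves {p} {q} {x} {y} pq px x≢q qy =
    (arcs-alive′ , acyclic-⊆⁺ G G′ (λ ab → [ removeArc-arc⁻ G p q ab ]) acyclic) ,
    LeavesIndeg1-transfer G G′ (removeArc-leaf⁻ G px x≢q) parent′ leaves1
    where
    G′ = removeArc G p q
    arcs-alive′ : ∀ a b → Arc G′ a b → V G′ a × V G′ b
    arcs-alive′ a b ab = arcs-alive a b (removeArc-arc⁻ G p q ab)
    parent′ : ∀ {z l} → IsLeaf G′ l → SoleParent G z l → ∃[ z′ ] SoleParent G′ z′ l
    parent′ lf zl = _ , soleParent-⊆ G G′ (removeArc-arc⁻ G p q) zl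
      (removeArc-arc⁺ G p q (proj₁ zl) λ (_ , l≡q) → leaf≢tail G (removeArc-leaf⁻ G px x≢q lf) qy l≡q)

  suppress-preserves : ∀ {u v w} → IsSubdivision G v → Arc G u v → Arc G v w →
                       DAGWithLeavesIndeg1 (suppress G u v w)
  suppress-preserves {u} {v} {w} sv uv vw =
    (arcs-alive′ , acyclic-⊆⁺ G G′ (Suppressed-arc⇒path s) acyclic) ,
    LeavesIndeg1-transfer G G′ (Suppressed-leaf⁻ s) parent′ leaves1
    where
    G′ = suppress G u v w
    s : Suppressed G v G′
    s = subdiv u w sv uv vw
    u≢v : u ≢ v
    u≢v = acyclic⇒irreflexive G acyclic uv
    w≢v : w ≢ v
    w≢v = ≢-sym (acyclic⇒irreflexive G acyclic vw)
    alive′ : ∀ {a} → V G a → a ≢ v → V G′ a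
    alive′ = suppress-alive⁺ G u v w
    arcs-alive′ : ∀ a b → Arc G′ a b → V G′ a × V G′ b
    arcs-alive′ a b ab with suppress-arc⁻ G u v w ab
    ... | inj₁ (refl , refl) =
      alive′ (proj₁ (arcs-alive u v uv)) u≢v , alive′ (proj₂ (arcs-alive v w vw)) w≢v
    ... | inj₂ (ab′ , a≢v , b≢v) =
      alive′ (proj₁ (arcs-alive a b ab′)) a≢v , alive′ (proj₂ (arcs-alive a b ab′)) b≢v
    parent′ : ∀ {z l} → IsLeaf G′ l → SoleParent G z l → ∃[ z′ ] SoleParent G′ z′ l
    parent′ {z} {l} (vl , _) (zl , only-z) with z ≟ v
    ... | yes refl with refl ← proj₂ (subdivision-soleChild G sv vw) l zl =
      u , suppress-arc-bypass G u v w , only-u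
      where
      only-u : ∀ a → Arc G′ a w → a ≡ u
      only-u a aw with suppress-arc⁻ G u v w aw
      ... | inj₁ (a≡u , _)        = a≡u
      ... | inj₂ (aw′ , a≢v , _) = ⊥-elim (a≢v (only-z a aw′))
    ... | no z≢v = z , suppress-arc⁺ G u v w zl z≢v (proj₂ (suppress-alive⁻ G u v w vl)) , only-z′
      where
      only-z′ : ∀ a → Arc G′ a l → a ≡ z
      only-z′ a al with suppress-arc⁻ G u v w al
      ... | inj₁ (_ , refl) = ⊥-elim (z≢v (sym (only-z v vw)))
      ... | inj₂ (al′ , _)  = only-z a al′

  Suppressed-preserves : ∀ {v G′} → Suppressed G v G′ → DAGWithLeavesIndeg1 G′
  Suppressed-preserves (not-subdiv _)        = dag₁
  Suppressed-preserves (subdiv _ _ sv uv vw) = suppress-preserves sv uv vw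

PickCherry-preserves : {G G′ : Graph n} → DAGWithLeavesIndeg1 G → PickCherry G G′ → DAGWithLeavesIndeg1 G′
PickCherry-preserves {G = G} dag₁ (standard x y p _ ly x≢y px py s) =
  Suppressed-preserves _ (removeLeaf-preserves G dag₁ ly py px x≢y) s
PickCherry-preserves {G = G} dag₁ (reticulated x y p q lx _ _ px qy (_ , q-nonleaf , _) pq s₁ s₂) =
  Suppressed-preserves _ (Suppressed-preserves _ (removeArc-preserves G dag₁ pq px x≢q qy) s₁) s₂
  where
  x≢q : x ≢ q
  x≢q refl = q-nonleaf (proj₂ lx)

-- Paths as lists

private
  variable
    R : A → A → Set
    a b c x y : A
    xs ys : List A

data Adjacent {A : Set} : List A → A → A → Set where
  here  : Adjacent (a ∷ b ∷ xs) a b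
  there : Adjacent xs a b → Adjacent (x ∷ xs) a b

Adjacent⇒∈ˡ : Adjacent xs a b → a ∈ xs
Adjacent⇒∈ˡ here      = here refl
Adjacent⇒∈ˡ (there d) = there (Adjacent⇒∈ˡ d)

Adjacent⇒∈ʳ : Adjacent xs a b → b ∈ xs
Adjacent⇒∈ʳ here      = there (here refl)
Adjacent⇒∈ʳ (there d) = there (Adjacent⇒∈ʳ d)

Adjacent⇒∈ʳ-tail : Adjacent (x ∷ xs) a b → b ∈ xs
Adjacent⇒∈ʳ-tail here      = here refl
Adjacent⇒∈ʳ-tail (there d) = Adjacent⇒∈ʳ d

Adjacent-∷⁻ : Adjacent (x ∷ xs) a b → a ≢ x → Adjacent xs a b
Adjacent-∷⁻ here      a≢x = ⊥-elim (a≢x refl)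
Adjacent-∷⁻ (there d) _   = d

Adjacent-++⁺ˡ : Adjacent xs a b → Adjacent (xs ++ ys) a b
Adjacent-++⁺ˡ here      = here
Adjacent-++⁺ˡ (there d) = there (Adjacent-++⁺ˡ d)

Adjacent-++⁻ˡ : ∀ xs → Adjacent (xs ++ ys) a b → b ∉ ys → Adjacent xs a b
Adjacent-++⁻ˡ []           d         b∉ys = ⊥-elim (b∉ys (Adjacent⇒∈ʳ d))
Adjacent-++⁻ˡ (x ∷ [])     here      b∉ys = ⊥-elim (b∉ys (here refl))
Adjacent-++⁻ˡ (x ∷ [])     (there d) b∉ys = ⊥-elim (b∉ys (Adjacent⇒∈ʳ d))
Adjacent-++⁻ˡ (x ∷ y ∷ xs) here      b∉ys = here
Adjacent-++⁻ˡ (x ∷ y ∷ xs) (there d) b∉ys = there (Adjacent-++⁻ˡ (y ∷ xs) d b∉ys)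

Adjacent-++⁻ʳ : ∀ xs → Adjacent (xs ++ ys) a b → a ∉ xs → Adjacent ys a b
Adjacent-++⁻ʳ []       d a∉xs = d
Adjacent-++⁻ʳ (x ∷ xs) d a∉xs =
  Adjacent-++⁻ʳ xs (Adjacent-∷⁻ d λ a≡x → a∉xs (here a≡x)) (λ a∈xs → a∉xs (there a∈xs))

Adjacent-∷ʳ-last : ∀ xs → Adjacent (xs ∷ʳ a ∷ʳ b) a b
Adjacent-∷ʳ-last []       = here
Adjacent-∷ʳ-last (x ∷ xs) = there (Adjacent-∷ʳ-last xs)

Adjacent-unique-pred : Unique xs → Adjacent xs a c → Adjacent xs b c → a ≡ b
Adjacent-unique-pred _       here      here       = refl
Adjacent-unique-pred (_ ∷ u) here      (there d′) = ⊥-elim (Unique[x∷xs]⇒x∉xs u (Adjacent⇒∈ʳ-tail d′))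
Adjacent-unique-pred (_ ∷ u) (there d) here       = ⊥-elim (Unique[x∷xs]⇒x∉xs u (Adjacent⇒∈ʳ-tail d))
Adjacent-unique-pred (_ ∷ u) (there d) (there d′) = Adjacent-unique-pred u d d′

Adjacent-head : Unique (x ∷ xs) → ¬ Adjacent (x ∷ xs) a x
Adjacent-head u d = Unique[x∷xs]⇒x∉xs u (Adjacent⇒∈ʳ-tail d)

Adjacent-index : ∀ xs (i j : Fin (length xs)) → Unique xs → Adjacent xs a b →
                 lookup xs i ≡ a → lookup xs j ≡ b → toℕ j ≡ suc (toℕ i)
Adjacent-index (x ∷ y ∷ xs) zero    zero          u        here xᵢ yⱼ =
  ⊥-elim (Unique[x∷xs]⇒x∉xs u (here (trans (sym xᵢ) yⱼ)))
Adjacent-index (x ∷ y ∷ xs) zero    (suc zero)    _        here _  _  = refl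
Adjacent-index (x ∷ y ∷ xs) zero    (suc (suc j)) (_ ∷ u)  here _  yⱼ =
  ⊥-elim (Unique[x∷xs]⇒x∉xs u (subst (_∈ xs) yⱼ (∈-lookup j)))
Adjacent-index (x ∷ y ∷ xs) (suc i) _             u        here xᵢ _  =
  ⊥-elim (Unique[x∷xs]⇒x∉xs u (subst (_∈ y ∷ xs) xᵢ (∈-lookup i)))
Adjacent-index (x ∷ xs)     zero    _             u   (there d) xᵢ _  =
  ⊥-elim (Unique[x∷xs]⇒x∉xs u (subst (_∈ xs) (sym xᵢ) (Adjacent⇒∈ˡ d)))
Adjacent-index (x ∷ xs)     (suc i) zero          u   (there d) _  xⱼ =
  ⊥-elim (Unique[x∷xs]⇒x∉xs u (subst (_∈ xs) (sym xⱼ) (Adjacent⇒∈ʳ d)))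
Adjacent-index (x ∷ xs)     (suc i) (suc j)       (_ ∷ u) (there d) xᵢ xⱼ =
  cong suc (Adjacent-index xs i j u d xᵢ xⱼ)

∈⇒predecessor : b ∈ xs → ∃[ a ] Adjacent (x ∷ xs) a b
∈⇒predecessor {x = x} (here refl) = x , here
∈⇒predecessor {xs = y ∷ _} (there b∈xs) with a , d ← ∈⇒predecessor {x = y} b∈xs = a , there d

∈⇒successor : ∀ xs → a ∈ xs → ∃[ b ] Adjacent (xs ++ y ∷ ys) a b
∈⇒successor {y = y} (x ∷ [])     (here refl)  = y , here
∈⇒successor         (x ∷ z ∷ xs) (here refl)  = z , here
∈⇒successor         (x ∷ xs)     (there a∈xs) with b , d ← ∈⇒successor xs a∈xs = b , there d

adjacent? : DecidableEquality A → ∀ xs (a b : A) → Dec (Adjacent xs a b)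
adjacent? _≟_ []           a b = no λ ()
adjacent? _≟_ (x ∷ [])     a b = no λ { (there ()) }
adjacent? _≟_ (x ∷ y ∷ xs) a b with x ≟ a | y ≟ b | adjacent? _≟_ (y ∷ xs) a b
... | yes refl | yes refl | _       = yes here
... | _        | _        | yes d   = yes (there d)
... | no x≢a   | _        | no ¬d   = no λ { here → x≢a refl ; (there d) → ¬d d }
... | yes _    | no y≢b   | no ¬d   = no λ { here → y≢b refl ; (there d) → ¬d d }

Linked-Adjacent : Linked R xs → Adjacent xs a b → R a b
Linked-Adjacent (r ∷ _)  here      = r
Linked-Adjacent (_ ∷ rs) (there d) = Linked-Adjacent rs d

Linked⇐Adjacent : (∀ {a b} → Adjacent xs a b → R a b) → Linked R xs
Linked⇐Adjacent {xs = []}         _   = []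
Linked⇐Adjacent {xs = x ∷ []}     _   = [-]
Linked⇐Adjacent {xs = x ∷ y ∷ xs} adj = adj here ∷ Linked⇐Adjacent (λ d → adj (there d))

Linked-sink≡last : ∀ xs {l} → Linked R (xs ∷ʳ l) → a ∈ xs ∷ʳ l → (∀ b → ¬ R a b) → a ≡ l
Linked-sink≡last xs rs a∈ sink with ∈-++⁻ xs a∈
... | inj₁ a∈xs        = let b , d = ∈⇒successor xs a∈xs in ⊥-elim (sink b (Linked-Adjacent rs d))
... | inj₂ (here a≡l) = a≡l

Linked-++⁻ˡ : ∀ xs → Linked R (xs ++ ys) → Linked R xs
Linked-++⁻ˡ []           _        = []
Linked-++⁻ˡ (x ∷ [])     _        = [-]
Linked-++⁻ˡ (x ∷ y ∷ xs) (r ∷ rs) = r ∷ Linked-++⁻ˡ (y ∷ xs) rs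

Linked-++⁻ʳ : ∀ xs → Linked R (xs ++ ys) → Linked R ys
Linked-++⁻ʳ []       rs = rs
Linked-++⁻ʳ (x ∷ xs) rs = Linked-++⁻ʳ xs (Linked.tail rs)

Linked-∷ʳ⁺ : ∀ xs → Linked R (xs ∷ʳ a) → R a b → Linked R (xs ∷ʳ a ∷ʳ b)
Linked-∷ʳ⁺ []           _        r′ = r′ ∷ [-]
Linked-∷ʳ⁺ (x ∷ [])     (r ∷ _)  r′ = r ∷ r′ ∷ [-]
Linked-∷ʳ⁺ (x ∷ y ∷ xs) (r ∷ rs) r′ = r ∷ Linked-∷ʳ⁺ (y ∷ xs) rs r′

Linked-∷ʳ⇒reaches : ∀ xs → Linked R (xs ∷ʳ a) → c ∈ xs → TransClosure R c a
Linked-∷ʳ⇒reaches (x ∷ [])     (r ∷ _)  (here refl) = [ r ]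
Linked-∷ʳ⇒reaches (x ∷ y ∷ xs) (r ∷ rs) (here refl) = r ∷ Linked-∷ʳ⇒reaches (y ∷ xs) rs (here refl)
Linked-∷ʳ⇒reaches (x ∷ xs)     rs       (there c∈xs) = Linked-∷ʳ⇒reaches xs (Linked.tail rs) c∈xs

Linked-connects-head : Linked R (x ∷ xs) → a ∈ x ∷ xs → Star (SymClosure R) a x
Linked-connects-head _        (here refl) = ε
Linked-connects-head (r ∷ rs) (there a∈)  = Linked-connects-head rs a∈ ◅◅ (bwd r ◅ ε)

Unique-∷⁺ : x ∉ xs → Unique xs → Unique (x ∷ xs)
Unique-∷⁺ {xs = xs} x∉xs u = ¬Any⇒All¬ xs x∉xs ∷ u

Unique-++⁻ : ∀ xs → Unique (xs ++ ys) → Unique xs × Unique ys × Disjoint xs ys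
Unique-++⁻ []       u = [] , u , λ ()
Unique-++⁻ (x ∷ xs) u@(_ ∷ u′) with uxs , uys , xs#ys ← Unique-++⁻ xs u′ =
  Unique-∷⁺ (λ x∈xs → x∉ (∈-++⁺ˡ x∈xs)) uxs , uys , x∷xs#ys
  where
  x∉ = Unique[x∷xs]⇒x∉xs u
  x∷xs#ys : Disjoint (x ∷ xs) _
  x∷xs#ys (here refl , x∈ys) = x∉ (∈-++⁺ʳ xs x∈ys)
  x∷xs#ys (there v∈xs , v∈ys) = xs#ys (v∈xs , v∈ys)

Unique-concat⁻ : {P : List (List A)} → Unique (concat P) → xs ∈ P → Unique xs
Unique-concat⁻ {P = ys ∷ P} u (here refl) = proj₁ (Unique-++⁻ ys u)
Unique-concat⁻ {P = ys ∷ P} u (there m)   = Unique-concat⁻ (proj₁ (proj₂ (Unique-++⁻ ys u))) m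

Unique-concat-≡ : {P : List (List A)} → Unique (concat P) →
                  xs ∈ P → ys ∈ P → a ∈ xs → a ∈ ys → xs ≡ ys
Unique-concat-≡ {P = zs ∷ P} u (here refl) (here refl) _ _ = refl
Unique-concat-≡ {P = zs ∷ P} u (here refl) (there m) a∈xs a∈ys =
  ⊥-elim (proj₂ (proj₂ (Unique-++⁻ zs u)) (a∈xs , ∈-concat⁺′ a∈ys m))
Unique-concat-≡ {P = zs ∷ P} u (there m) (here refl) a∈xs a∈ys =
  ⊥-elim (proj₂ (proj₂ (Unique-++⁻ zs u)) (a∈ys , ∈-concat⁺′ a∈xs m))
Unique-concat-≡ {P = zs ∷ P} u (there m) (there m′) a∈xs a∈ys =
  Unique-concat-≡ (proj₁ (proj₂ (Unique-++⁻ zs u))) m m′ a∈xs a∈ys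

Unique-concat-map⁺ : {B : Set} (f : A → List B) → Unique xs → (∀ {x} → x ∈ xs → Unique (f x)) →
                     (∀ {x y z} → x ∈ xs → y ∈ xs → z ∈ f x → z ∈ f y → x ≡ y) →
                     Unique (concat (map f xs))
Unique-concat-map⁺ {xs = []} f _ _ _ = []
Unique-concat-map⁺ {xs = x ∷ xs} f u@(_ ∷ u′) unique-f shared⇒≡ =
  ++⁺ (unique-f (here refl)) rest-unique fx#rest
  where
  rest-unique : Unique (concat (map f xs))
  rest-unique =
    Unique-concat-map⁺ f u′ (λ y∈ → unique-f (there y∈)) (λ x∈ y∈ → shared⇒≡ (there x∈) (there y∈))
  fx#rest : Disjoint (f x) (concat (map f xs))
  fx#rest (z∈fx , z∈rest)
    with ys , z∈ys , ys∈ ← ∈-concat⁻′ (map f xs) z∈rest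
    with y , y∈xs , refl ← ∈-map⁻ f ys∈
    with refl ← shared⇒≡ (here refl) (there y∈xs) z∈fx z∈ys
    = Unique[x∷xs]⇒x∉xs u y∈xs

∷ʳ-suffix : ∀ (xs ys : List A) {zs l} → xs ++ ys ≡ zs ∷ʳ l →
            ys ≡ [] ⊎ ∃[ ys′ ] ys ≡ ys′ ∷ʳ l
∷ʳ-suffix xs ys eq with initLast ys
... | []        = inj₁ refl
... | ys′ ∷ʳ′ y =
  inj₂ (ys′ , cong (ys′ ∷ʳ_) (∷ʳ-injectiveʳ (xs ++ ys′) _ (trans (++-assoc xs ys′ (y ∷ [])) eq)))

∈-∃∷ʳ++ : a ∈ xs → ∃[ ys ] ∃[ zs ] xs ≡ (ys ∷ʳ a) ++ zs
∈-∃∷ʳ++ {a = a} a∈xs with ys , zs , refl ← ∈-∃++ a∈xs = ys , zs , sym (++-assoc ys (a ∷ []) zs)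

∈-++-∷⁻ : ∀ (P : List A) {Q} → a ∈ P ++ b ∷ Q → a ≢ b → a ∈ P ++ Q
∈-++-∷⁻ P a∈ a≢b with ∈-++⁻ P a∈
... | inj₁ a∈P          = ∈-++⁺ˡ a∈P
... | inj₂ (here a≡b)   = ⊥-elim (a≢b a≡b)
... | inj₂ (there a∈Q)  = ∈-++⁺ʳ P a∈Q

∈-++-∷⁺ : ∀ (P : List A) {Q} → a ∈ P ++ Q → a ∈ P ++ b ∷ Q
∈-++-∷⁺ P a∈ with ∈-++⁻ P a∈
... | inj₁ a∈P = ∈-++⁺ˡ a∈P
... | inj₂ a∈Q = ∈-++⁺ʳ P (there a∈Q)

concat-extract : ∀ (P : List (List A)) xs Q → concat (P ++ xs ∷ Q) ↭ xs ++ concat (P ++ Q)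
concat-extract P xs Q = begin
  concat (P ++ xs ∷ Q)              ≡⟨ concat-++ P (xs ∷ Q) ⟨
  concat P ++ xs ++ concat Q        ↭⟨ shifts (concat P) xs ⟩
  xs ++ concat P ++ concat Q        ≡⟨ cong (xs ++_) (concat-++ P Q) ⟩
  xs ++ concat (P ++ Q)             ∎
  where open PermutationReasoning

concat-regroup : ∀ (P Q R S : List (List A)) γ β x → P ++ Q ≡ R ++ (γ ++ β) ∷ S →
                 concat ((γ ∷ʳ x) ∷ β ∷ R ++ S) ↭ concat (P ++ (x ∷ []) ∷ Q)
concat-regroup P Q R S γ β x eq = begin
  (γ ∷ʳ x) ++ β ++ concat (R ++ S)  ≡⟨ ++-assoc γ (x ∷ []) _ ⟩
  γ ++ x ∷ β ++ concat (R ++ S)     ↭⟨ shift x γ _ ⟩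
  x ∷ γ ++ β ++ concat (R ++ S)     ≡⟨ cong (x ∷_) (++-assoc γ β _) ⟨
  x ∷ (γ ++ β) ++ concat (R ++ S)   ↭⟨ prep x (concat-extract R (γ ++ β) S) ⟨
  x ∷ concat (R ++ (γ ++ β) ∷ S)    ≡⟨ cong (λ T → x ∷ concat T) eq ⟨
  x ∷ concat (P ++ Q)               ↭⟨ concat-extract P (x ∷ []) Q ⟨
  concat (P ++ (x ∷ []) ∷ Q)        ∎
  where open PermutationReasoning

module InsertBefore {n : ℕ} (w v : Fin n) where

  insertBefore : List (Fin n) → List (Fin n)
  insertBefore []       = []
  insertBefore (x ∷ xs) with x ≟ w
  ... | yes _ = v ∷ x ∷ insertBefore xs
  ... | no  _ = x ∷ insertBefore xs

  insertBefore-≢ : ∀ {x} xs → x ≢ w → insertBefore (x ∷ xs) ≡ x ∷ insertBefore xs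
  insertBefore-≢ {x} xs x≢w with x ≟ w
  ... | yes x≡w = ⊥-elim (x≢w x≡w)
  ... | no  _   = refl

  insertBefore-≡ : ∀ xs → insertBefore (w ∷ xs) ≡ v ∷ w ∷ insertBefore xs
  insertBefore-≡ xs with w ≟ w
  ... | yes _   = refl
  ... | no  w≢w = ⊥-elim (w≢w refl)

  insertBefore-++ : ∀ xs ys → insertBefore (xs ++ ys) ≡ insertBefore xs ++ insertBefore ys
  insertBefore-++ []       ys = refl
  insertBefore-++ (x ∷ xs) ys with x ≟ w
  ... | yes _ = cong (λ zs → v ∷ x ∷ zs) (insertBefore-++ xs ys)
  ... | no  _ = cong (x ∷_) (insertBefore-++ xs ys)

  concat-map-insertBefore : ∀ P → concat (map insertBefore P) ≡ insertBefore (concat P)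
  concat-map-insertBefore []      = refl
  concat-map-insertBefore (π ∷ P) =
    trans (cong (insertBefore π ++_) (concat-map-insertBefore P)) (sym (insertBefore-++ π (concat P)))

  insertBefore-∷ʳ : ∀ xs l → ∃[ ys ] insertBefore (xs ∷ʳ l) ≡ ys ∷ʳ l
  insertBefore-∷ʳ xs l with l ≟ w | insertBefore-++ xs (l ∷ [])
  ... | yes _ | eq = insertBefore xs ∷ʳ v , trans eq (sym (++-assoc (insertBefore xs) (v ∷ []) (l ∷ [])))
  ... | no  _ | eq = insertBefore xs , eq

  ∈-insertBefore⁻ : ∀ {a xs} → a ∈ insertBefore xs → a ∈ xs ⊎ (a ≡ v × w ∈ xs)
  ∈-insertBefore⁻ {xs = x ∷ xs} a∈ with x ≟ w | a∈
  ... | yes x≡w | here a≡v          = inj₂ (a≡v , here (sym x≡w))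
  ... | yes _   | there (here a≡x)  = inj₁ (here a≡x)
  ... | yes _   | there (there a∈′) = ⊎-map there (map₂ there) (∈-insertBefore⁻ a∈′)
  ... | no  _   | here a≡x          = inj₁ (here a≡x)
  ... | no  _   | there a∈′         = ⊎-map there (map₂ there) (∈-insertBefore⁻ a∈′)

  ∈-insertBefore⁻-old : ∀ {a xs} → a ∈ insertBefore xs → a ≢ v → a ∈ xs
  ∈-insertBefore⁻-old a∈ a≢v with ∈-insertBefore⁻ a∈
  ... | inj₁ a∈xs      = a∈xs
  ... | inj₂ (a≡v , _) = ⊥-elim (a≢v a≡v)

  ∈-insertBefore⁻-new : ∀ {xs} → v ∈ insertBefore xs → v ∉ xs → w ∈ xs
  ∈-insertBefore⁻-new v∈ v∉ with ∈-insertBefore⁻ v∈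
  ... | inj₁ v∈xs      = ⊥-elim (v∉ v∈xs)
  ... | inj₂ (_ , w∈xs) = w∈xs

  ∈-insertBefore⁺ : ∀ {a xs} → a ∈ xs → a ∈ insertBefore xs
  ∈-insertBefore⁺ {xs = x ∷ xs} a∈ with x ≟ w | a∈
  ... | yes _ | here a≡x  = there (here a≡x)
  ... | yes _ | there a∈′ = there (there (∈-insertBefore⁺ a∈′))
  ... | no  _ | here a≡x  = here a≡x
  ... | no  _ | there a∈′ = there (∈-insertBefore⁺ a∈′)

  ∈-insertBefore-new : ∀ {xs} → w ∈ xs → v ∈ insertBefore xs
  ∈-insertBefore-new {x ∷ xs} w∈ with x ≟ w | w∈
  ... | yes _   | _          = here refl
  ... | no  x≢w | here w≡x   = ⊥-elim (x≢w (sym w≡x))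
  ... | no  _   | there w∈′  = there (∈-insertBefore-new w∈′)

  ∉-insertBefore : ∀ {a xs} → a ∉ xs → a ≢ v → a ∉ insertBefore xs
  ∉-insertBefore a∉ a≢v a∈ with ∈-insertBefore⁻ a∈
  ... | inj₁ a∈xs      = a∉ a∈xs
  ... | inj₂ (a≡v , _) = a≢v a≡v

  Unique-insertBefore : ∀ {xs} → Unique xs → v ∉ xs → Unique (insertBefore xs)
  Unique-insertBefore {[]}     u v∉ = u
  Unique-insertBefore {x ∷ xs} u@(_ ∷ u′) v∉ with x ≟ w
  ... | yes refl = Unique-∷⁺ v∉w∷ (Unique-∷⁺ x∉ (Unique-insertBefore u′ λ v∈ → v∉ (there v∈)))
    where
    x∉ = ∉-insertBefore (Unique[x∷xs]⇒x∉xs u) λ x≡v → v∉ (here (sym x≡v))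
    v∉w∷ : v ∉ w ∷ insertBefore xs
    v∉w∷ (here v≡w) = v∉ (here v≡w)
    v∉w∷ (there v∈) with ∈-insertBefore⁻ v∈
    ... | inj₁ v∈xs       = v∉ (there v∈xs)
    ... | inj₂ (_ , w∈xs) = Unique[x∷xs]⇒x∉xs u w∈xs
  ... | no _ = Unique-∷⁺ (∉-insertBefore (Unique[x∷xs]⇒x∉xs u) λ x≡v → v∉ (here (sym x≡v)))
                         (Unique-insertBefore u′ λ v∈ → v∉ (there v∈))

  Adjacent-insertBefore : ∀ {xs a b} → Adjacent xs a b → b ≢ w → Adjacent (insertBefore xs) a b
  Adjacent-insertBefore {x ∷ y ∷ xs} here b≢w with x ≟ w
  ... | yes _ rewrite insertBefore-≢ xs b≢w = there here
  ... | no  _ rewrite insertBefore-≢ xs b≢w = here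
  Adjacent-insertBefore {x ∷ xs} (there d) b≢w with x ≟ w
  ... | yes _ = there (there (Adjacent-insertBefore d b≢w))
  ... | no  _ = there (Adjacent-insertBefore d b≢w)

  Adjacent-insertBefore-new : ∀ {xs} → w ∈ xs → Adjacent (insertBefore xs) v w
  Adjacent-insertBefore-new {x ∷ xs} w∈ with x ≟ w | w∈
  ... | yes refl | _          = here
  ... | no  x≢w  | here w≡x   = ⊥-elim (x≢w (sym w≡x))
  ... | no  _    | there w∈′  = there (Adjacent-insertBefore-new w∈′)

  Adjacent-insertBefore-pred : ∀ {xs a} → Adjacent xs a w → Adjacent (insertBefore xs) a v
  Adjacent-insertBefore-pred {x ∷ .w ∷ xs} here with x ≟ w
  ... | yes _ rewrite insertBefore-≡ xs = there here
  ... | no  _ rewrite insertBefore-≡ xs = here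
  Adjacent-insertBefore-pred {x ∷ xs} (there d) with x ≟ w
  ... | yes _ = there (there (Adjacent-insertBefore-pred d))
  ... | no  _ = there (Adjacent-insertBefore-pred d)

  module _ {R′ R : Fin n → Fin n → Set} (R′⇒R : ∀ {a b} → R′ a b → b ≢ w → R a b)
           (R′-into-w : ∀ {a} → R′ a w → R a v) (Rvw : R v w) where

    private
      Linked-∷-insertBefore : ∀ {x y xs} → R′ x y → Linked R (insertBefore (y ∷ xs)) →
                              Linked R (x ∷ insertBefore (y ∷ xs))
      Linked-∷-insertBefore {y = y} r rs with y ≟ w
      ... | yes refl = R′-into-w r ∷ rs
      ... | no  y≢w  = R′⇒R r y≢w ∷ rs

    Linked-insertBefore : ∀ {xs} → Linked R′ xs → Linked R (insertBefore xs)
    Linked-insertBefore [] = []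
    Linked-insertBefore {x ∷ []} [-] with x ≟ w
    ... | yes refl = Rvw ∷ [-]
    ... | no  _    = [-]
    Linked-insertBefore {x ∷ y ∷ xs} (r ∷ rs) with x ≟ w
    ... | yes refl = Rvw ∷ Linked-∷-insertBefore r (Linked-insertBefore rs)
    ... | no  _    = Linked-∷-insertBefore r (Linked-insertBefore rs)

-- Leaf path partitions

module _ {n : ℕ} (G : Graph n) where

  record LeafPath (π : List (Fin n)) : Set where
    field
      linked     : Linked (Arc G) π
      chordless  : ∀ {a b} → a ∈ π → b ∈ π → Arc G a b → Adjacent π a b
      endsAtLeaf : EndsAtLeaf G π

  record VertexEnumeration (xs : List (Fin n)) : Set where
    field
      unique   : Unique xs
      sound    : ∀ {v} → v ∈ xs → V G v
      complete : ∀ {v} → V G v → v ∈ xs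

  record LeafPathPartition (P : List (List (Fin n))) : Set where
    field
      leafPaths   : ∀ {π} → π ∈ P → LeafPath π
      enumeration : VertexEnumeration (concat P)

  HasLeafPathPartition : Set
  HasLeafPathPartition = ∃ LeafPathPartition

open LeafPath
open LeafPathPartition

VertexEnumeration-↭ : {G : Graph n} {xs ys : List (Fin n)} → xs ↭ ys →
                      VertexEnumeration G xs → VertexEnumeration G ys
VertexEnumeration-↭ xs↭ys enum = record
  { unique   = Setoid↭.Unique-resp-↭ (setoid _) (↭⇒↭ₛ xs↭ys) unique
  ; sound    = λ a∈ys → sound (∈-resp-↭ (↭-sym xs↭ys) a∈ys)
  ; complete = λ va → ∈-resp-↭ xs↭ys (complete va)
  }
  where open VertexEnumeration enum

LeafPath-transfer : {G G′ : Graph n} {π : List (Fin n)} →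
                    (∀ {a b} → Arc G′ a b → Arc G a b) → (∀ {l} → IsLeaf G′ l → IsLeaf G l) →
                    (∀ {a b} → a ∈ π → b ∈ π → Arc G a b → Arc G′ a b ⊎ Adjacent π a b) →
                    LeafPath G′ π → LeafPath G π
LeafPath-transfer G′⊆G leaf⁻ new-arcs path = record
  { linked     = Linked.map G′⊆G (linked path)
  ; chordless  = λ a∈ b∈ ab → [ chordless path a∈ b∈ , (λ d → d) ]′ (new-arcs a∈ b∈ ab)
  ; endsAtLeaf = let (ps , l , eq , lf) = endsAtLeaf path in ps , l , eq , leaf⁻ lf
  }

-- Undoing a cherry pick

module _ (G : Graph n) {p x y : Fin n}
         (ly : IsLeaf G y) (py : SoleParent G p y) (px : Arc G p x) (x≢y : x ≢ y) where

  private
    G′ = removeLeaf G y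

  partition-removeLeaf⁻ : HasLeafPathPartition G′ → HasLeafPathPartition G
  partition-removeLeaf⁻ (P , part) = (y ∷ []) ∷ P , record { leafPaths = paths ; enumeration = enum }
    where
    open VertexEnumeration (enumeration part)
    ≢y : ∀ {a} → a ∈ concat P → a ≢ y
    ≢y a∈ = proj₂ (removeLeaf-alive⁻ G y (sound a∈))
    paths : ∀ {π} → π ∈ (y ∷ []) ∷ P → LeafPath G π
    paths (here refl) = record
      { linked     = [-]
      ; chordless  = λ { (here refl) _ yb → ⊥-elim (leaf⇒noArc G ly _ yb) }
      ; endsAtLeaf = [] , y , refl , ly
      }
    paths (there π∈) =
      LeafPath-transfer (λ ab → proj₁ (removeLeaf-arc⁻ G y ab)) (removeLeaf-leaf⁻ G py px x≢y)
        (λ _ b∈ ab → inj₁ (removeLeaf-arc⁺ G y ab (≢y (∈-concat⁺′ b∈ π∈)))) (leafPaths part π∈)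
    enum : VertexEnumeration G (y ∷ concat P)
    enum = record
      { unique   = Unique-∷⁺ (λ y∈ → ≢y y∈ refl) unique
      ; sound    = λ { (here refl) → proj₁ ly ; (there a∈) → proj₁ (removeLeaf-alive⁻ G y (sound a∈)) }
      ; complete = complete′
      }
      where
      complete′ : ∀ {a} → V G a → a ∈ y ∷ concat P
      complete′ {a} va with a ≟ y
      ... | yes refl = here refl
      ... | no  a≢y  = there (complete (removeLeaf-alive⁺ G y va a≢y))

-- The child w must have v as its only parent: otherwise the arc into w on w's path need not
-- come from v once v is put back in front of w.
module _ (G : Graph n) {u v w : Fin n} (dag : IsDAG G) (sv : IsSubdivision G v)
         (uv : Arc G u v) (vw : Arc G v w) (only-v : ∀ a → Arc G a w → a ≡ v) where

  private
    G′ = suppress G u v w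
    open InsertBefore w v
    only-u : ∀ a → Arc G a v → a ≡ u
    only-u = proj₂ (subdivision-soleParent G sv uv)
    only-w : ∀ b → Arc G v b → b ≡ w
    only-w = proj₂ (subdivision-soleChild G sv vw)

  LeafPath-insertBefore : ∀ {π} → v ∉ π → LeafPath G′ π → LeafPath G (insertBefore π)
  LeafPath-insertBefore {π} v∉π path = record
    { linked     = Linked-insertBefore G′⇒G into-w vw (linked path)
    ; chordless  = chordless′
    ; endsAtLeaf = endsAtLeaf′ (endsAtLeaf path)
    }
    where
    G′⇒G : ∀ {a b} → Arc G′ a b → b ≢ w → Arc G a b
    G′⇒G ab b≢w with suppress-arc⁻ G u v w ab
    ... | inj₁ (_ , b≡w) = ⊥-elim (b≢w b≡w)
    ... | inj₂ (ab′ , _) = ab′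
    into-w : ∀ {a} → Arc G′ a w → Arc G a v
    into-w {a} aw with suppress-arc⁻ G u v w aw
    ... | inj₁ (refl , _)      = uv
    ... | inj₂ (aw′ , a≢v , _) = ⊥-elim (a≢v (only-v a aw′))
    chordless′ : ∀ {a b} → a ∈ insertBefore π → b ∈ insertBefore π → Arc G a b →
                 Adjacent (insertBefore π) a b
    chordless′ {a} {b} a∈ b∈ ab with a ≟ v | b ≟ v
    ... | yes refl | _ with refl ← only-w b ab = Adjacent-insertBefore-new (∈-insertBefore⁻-new a∈ v∉π)
    ... | no a≢v | yes refl with refl ← only-u a ab =
      Adjacent-insertBefore-pred
        (chordless path (∈-insertBefore⁻-old a∈ a≢v) (∈-insertBefore⁻-new b∈ v∉π)
          (suppress-arc-bypass G u v w))
    ... | no a≢v | no b≢v =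
      Adjacent-insertBefore
        (chordless path (∈-insertBefore⁻-old a∈ a≢v) (∈-insertBefore⁻-old b∈ b≢v)
          (suppress-arc⁺ G u v w ab a≢v b≢v))
        (λ { refl → a≢v (only-v a ab) })
    endsAtLeaf′ : EndsAtLeaf G′ π → EndsAtLeaf G (insertBefore π)
    endsAtLeaf′ (ps , l , refl , lf) with ys , eq ← insertBefore-∷ʳ ps l =
      ys , l , eq , Suppressed-leaf⁻ {G = G} {v} (subdiv u w sv uv vw) lf

  enumeration-insertBefore : ∀ {xs} → VertexEnumeration G′ xs → VertexEnumeration G (insertBefore xs)
  enumeration-insertBefore {xs} enum = record
    { unique   = Unique-insertBefore unique λ v∈ → proj₂ (suppress-alive⁻ G u v w (sound v∈)) refl
    ; sound    = sound′
    ; complete = complete′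
    }
    where
    open VertexEnumeration enum
    sound′ : ∀ {a} → a ∈ insertBefore xs → V G a
    sound′ a∈ with ∈-insertBefore⁻ a∈
    ... | inj₁ a∈xs       = proj₁ (suppress-alive⁻ G u v w (sound a∈xs))
    ... | inj₂ (refl , _) = proj₁ sv
    complete′ : ∀ {a} → V G a → a ∈ insertBefore xs
    complete′ {a} va with a ≟ v
    ... | yes refl = ∈-insertBefore-new (complete (suppress-alive⁺ G u v w (proj₂ (proj₁ dag v w vw)) w≢v))
      where
      w≢v : w ≢ v
      w≢v w≡v = acyclic⇒irreflexive G (proj₂ dag) vw (sym w≡v)
    ... | no a≢v = ∈-insertBefore⁺ (complete (suppress-alive⁺ G u v w va a≢v))

  partition-suppress⁻ : HasLeafPathPartition G′ → HasLeafPathPartition G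
  partition-suppress⁻ (P , part) = map insertBefore P , record
    { leafPaths   = paths
    ; enumeration = subst (VertexEnumeration G) (sym (concat-map-insertBefore P))
                      (enumeration-insertBefore (enumeration part))
    }
    where
    paths : ∀ {π} → π ∈ map insertBefore P → LeafPath G π
    paths π∈ with π , π∈P , refl ← ∈-map⁻ insertBefore π∈ =
      LeafPath-insertBefore
        (λ v∈π → proj₂ (suppress-alive⁻ G u v w (sound (∈-concat⁺′ v∈π π∈P))) refl) (leafPaths part π∈P)
      where open VertexEnumeration (enumeration part)

partition-Suppressed⁻ : {G G′ : Graph n} {v : Fin n} → IsDAG G → Suppressed G v G′ →
                        (∃[ x ] SoleParent G v x) → HasLeafPathPartition G′ → HasLeafPathPartition G
partition-Suppressed⁻ dag (not-subdiv _) _ = id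
partition-Suppressed⁻ {G = G} dag (subdiv u w sv uv vw) (x , vx , only-v)
  with refl ← proj₂ (subdivision-soleChild G sv vw) x vx =
  partition-suppress⁻ G dag sv uv vx only-v

module _ (G : Graph n) {p q x : Fin n} (dag : IsDAG G) (pq : Arc G p q) (px : Arc G p x) (lx : IsLeaf G x)
         (only-p : ∀ a → Arc G a x → a ≡ p) (x≢q : x ≢ q) where

  private
    G₀ = removeArc G p q

    G₀⊆G : ∀ {a b} → Arc G₀ a b → Arc G a b
    G₀⊆G ab = removeArc-arc⁻ G p q ab

    leaf⁻ : ∀ {l} → IsLeaf G₀ l → IsLeaf G l
    leaf⁻ = removeArc-leaf⁻ G px x≢q

    px₀ : Arc G₀ p x
    px₀ = removeArc-arc⁺ G p q px λ (_ , x≡q) → x≢q x≡q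

    q∉path-to-p : ∀ γ → Linked (Arc G₀) (γ ∷ʳ p) → q ∉ γ ∷ʳ p
    q∉path-to-p γ rs q∈ with ∈-++⁻ γ q∈
    ... | inj₁ q∈γ        = proj₂ dag q (Linked-∷ʳ⇒reaches γ (Linked.map G₀⊆G rs) q∈γ Plus.∷ʳ pq)
    ... | inj₂ (here q≡p) = acyclic⇒irreflexive G (proj₂ dag) pq (sym q≡p)

  LeafPath-removeArc⁻ : ∀ {σ} → (p ∈ σ → q ∉ σ) → LeafPath G₀ σ → LeafPath G σ
  LeafPath-removeArc⁻ p∈⇒q∉ = LeafPath-transfer G₀⊆G leaf⁻ only-old-arcs
    where
    only-old-arcs : ∀ {a b} → a ∈ _ → b ∈ _ → Arc G a b → Arc G₀ a b ⊎ Adjacent _ a b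
    only-old-arcs a∈ b∈ ab with removeArc-arc-split G p q ab
    ... | inj₁ ab₀          = inj₁ ab₀
    ... | inj₂ (refl , refl) = ⊥-elim (p∈⇒q∉ a∈ b∈)

  module _ (α β : List (Fin n))
           (ρ-path : LeafPath G₀ ((α ∷ʳ p) ++ β)) (ρ-unique : Unique ((α ∷ʳ p) ++ β)) where

    private
      γ = α ∷ʳ p
      γ#β = proj₂ (proj₂ (Unique-++⁻ γ ρ-unique))
      γ-linked : Linked (Arc G₀) γ
      γ-linked = Linked-++⁻ˡ γ (linked ρ-path)

    LeafPath-prefix-attach : LeafPath G (γ ∷ʳ x)
    LeafPath-prefix-attach = record
      { linked     = Linked-∷ʳ⁺ α (Linked.map G₀⊆G γ-linked) px
      ; chordless  = chordless′
      ; endsAtLeaf = γ , x , refl , lx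
      }
      where
      chordless′ : ∀ {a b} → a ∈ γ ∷ʳ x → b ∈ γ ∷ʳ x → Arc G a b → Adjacent (γ ∷ʳ x) a b
      chordless′ {a} {b} a∈ b∈ ab with ∈-++⁻ γ a∈ | ∈-++⁻ γ b∈
      ... | inj₂ (here refl) | _                = ⊥-elim (leaf⇒noArc G lx b ab)
      ... | inj₁ _           | inj₂ (here refl) with refl ← only-p a ab = Adjacent-∷ʳ-last α
      ... | inj₁ a∈γ         | inj₁ b∈γ with removeArc-arc-split G p q ab
      ...   | inj₂ (refl , refl) = ⊥-elim (q∉path-to-p α γ-linked b∈γ)
      ...   | inj₁ ab₀ =
        Adjacent-++⁺ˡ
          (Adjacent-++⁻ˡ γ (chordless ρ-path (∈-++⁺ˡ a∈γ) (∈-++⁺ˡ b∈γ) ab₀) λ b∈β → γ#β (b∈γ , b∈β))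

    LeafPath-suffix : LeafPath G β
    LeafPath-suffix = record
      { linked     = Linked.map G₀⊆G (Linked-++⁻ʳ γ (linked ρ-path))
      ; chordless  = chordless′
      ; endsAtLeaf = endsAtLeaf′ (endsAtLeaf ρ-path)
      }
      where
      p∈γ : p ∈ γ
      p∈γ = ∈-++⁺ʳ α (here refl)
      chordless′ : ∀ {a b} → a ∈ β → b ∈ β → Arc G a b → Adjacent β a b
      chordless′ {a} {b} a∈ b∈ ab with removeArc-arc-split G p q ab
      ... | inj₂ (refl , refl) = ⊥-elim (γ#β (p∈γ , a∈))
      ... | inj₁ ab₀ =
        Adjacent-++⁻ʳ γ (chordless ρ-path (∈-++⁺ʳ γ a∈) (∈-++⁺ʳ γ b∈) ab₀)
          λ a∈γ → γ#β (a∈γ , a∈)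
      endsAtLeaf′ : EndsAtLeaf G₀ (γ ++ β) → EndsAtLeaf G β
      endsAtLeaf′ (ps , l , eq , ll) with ∷ʳ-suffix γ β eq
      ... | inj₂ (β′ , refl) = β′ , l , refl , leaf⁻ ll
      ... | inj₁ refl with refl ← ∷ʳ-injectiveʳ α ps (trans (sym (++-identityʳ γ)) eq) =
        ⊥-elim (leaf⇒noArc G₀ ll x px₀)

  private
    enumeration⁻ : ∀ {xs} → VertexEnumeration G₀ xs → VertexEnumeration G xs
    enumeration⁻ enum = record { unique = unique ; sound = sound ; complete = complete }
      where open VertexEnumeration enum

  module _ {P : List (List (Fin n))} (part : LeafPathPartition G₀ P) where

    open VertexEnumeration (enumeration part)

    partition-attached : ∀ γ → (γ ∷ʳ p ∷ʳ x) ∈ P → LeafPathPartition G P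
    partition-attached γ π∈P = record
      { leafPaths   = λ σ∈P → LeafPath-removeArc⁻ (q∉ σ∈P) (leafPaths part σ∈P)
      ; enumeration = enumeration⁻ (enumeration part)
      }
      where
      q∉ : ∀ {σ} → σ ∈ P → p ∈ σ → q ∉ σ
      q∉ σ∈P p∈σ q∈σ
        with refl ← Unique-concat-≡ unique σ∈P π∈P p∈σ (∈-++⁺ˡ (∈-++⁺ʳ γ (here refl)))
        with ∈-++⁻ (γ ∷ʳ p) q∈σ
      ... | inj₁ q∈γp =
        q∉path-to-p γ (Linked-++⁻ˡ (γ ∷ʳ p) (linked (leafPaths part π∈P))) q∈γp
      ... | inj₂ (here q≡x) = x≢q (sym q≡x)

    private
      p∉[x] : p ∉ x ∷ []
      p∉[x] (here p≡x) = acyclic⇒irreflexive G (proj₂ dag) px p≡x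

    partition-split : (x ∷ []) ∈ P → HasLeafPathPartition G
    partition-split π∈P
      with A , B , refl ← ∈-∃++ π∈P
      with ρ , p∈ρ , ρ∈P ← ∈-concat⁻′ _ (complete (proj₁ (proj₁ dag p q pq)))
      with α , β , refl ← ∈-∃∷ʳ++ p∈ρ
      with C , D , AB≡ ← ∈-∃++ (∈-++-∷⁻ A ρ∈P λ ρ≡[x] → p∉[x] (subst (p ∈_) ρ≡[x] p∈ρ))
      = P′ , record { leafPaths = paths ; enumeration = enumeration′ }
      where
      P′ = (α ∷ʳ p ∷ʳ x) ∷ β ∷ C ++ D
      enumeration′ : VertexEnumeration G (concat P′)
      enumeration′ = VertexEnumeration-↭ (↭-sym (concat-regroup A B C D (α ∷ʳ p) β x AB≡))
                       (enumeration⁻ (enumeration part))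
      p∉rest : p ∉ concat (β ∷ C ++ D)
      p∉rest p∈ = proj₂ (proj₂ (Unique-++⁻ (α ∷ʳ p ∷ʳ x) (VertexEnumeration.unique enumeration′)))
                    (∈-++⁺ˡ (∈-++⁺ʳ α (here refl)) , p∈)
      ρ-path = leafPaths part ρ∈P
      ρ-unique = Unique-concat⁻ unique ρ∈P
      paths : ∀ {σ} → σ ∈ P′ → LeafPath G σ
      paths (here refl)          = LeafPath-prefix-attach α β ρ-path ρ-unique
      paths (there (here refl))  = LeafPath-suffix α β ρ-path ρ-unique
      paths (there (there σ∈CD)) =
        LeafPath-removeArc⁻ (λ p∈σ _ → p∉rest (∈-++⁺ʳ β (∈-concat⁺′ p∈σ σ∈CD)))
          (leafPaths part (∈-++-∷⁺ A (subst (_ ∈_) (sym AB≡) (∈-++-∷⁺ C σ∈CD))))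

  partition-removeArc⁻ : HasLeafPathPartition G₀ → HasLeafPathPartition G
  partition-removeArc⁻ (P , part)
    with π , x∈π , π∈P ← ∈-concat⁻′ P (VertexEnumeration.complete (enumeration part) (proj₁ lx))
    with π-linked ← linked (leafPaths part π∈P)
    with ps , l , refl , _ ← endsAtLeaf (leafPaths part π∈P)
    with refl ← Linked-sink≡last ps π-linked x∈π (λ b xb → leaf⇒noArc G lx b (G₀⊆G xb))
    with initLast ps
  ... | []      = partition-split part π∈P
  ... | γ ∷ʳ′ a with refl ← only-p a (G₀⊆G (Linked-Adjacent π-linked (Adjacent-∷ʳ-last γ))) =
    P , partition-attached part γ π∈P

partition-PickCherry⁻ : {G G′ : Graph n} → DAGWithLeavesIndeg1 G → PickCherry G G′ →
                        HasLeafPathPartition G′ → HasLeafPathPartition G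
partition-PickCherry⁻ {G = G} dag₁@(_ , leaves1) (standard x y p lx ly x≢y px py s) =
  partition-removeLeaf⁻ G ly (leaf-soleParent G leaves1 ly py) px x≢y
  ∘ partition-Suppressed⁻ (proj₁ (removeLeaf-preserves G dag₁ ly py px x≢y)) s (x , px′)
  where
  px′ : SoleParent (removeLeaf G y) p x
  px′ = soleParent-⊆ G (removeLeaf G y) (λ ab → proj₁ (removeLeaf-arc⁻ G y ab))
          (leaf-soleParent G leaves1 lx px) (removeLeaf-arc⁺ G y px x≢y)
partition-PickCherry⁻ {G = G} dag₁@(dag , leaves1)
  (reticulated x y p q lx ly x≢y px qy (_ , q-nonleaf , _) pq {G₁} s₁ s₂) =
  partition-removeArc⁻ G dag pq px lx (proj₂ (leaf-soleParent G leaves1 lx px)) x≢q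
  ∘ partition-Suppressed⁻ (proj₁ dag₀) s₁ (x , px₀)
  ∘ partition-Suppressed⁻ (proj₁ (Suppressed-preserves _ dag₀ s₁)) s₂ (y , qy₁)
  where
  G₀ = removeArc G p q
  x≢q : x ≢ q
  x≢q refl = q-nonleaf (proj₂ lx)
  q≢p : q ≢ p
  q≢p q≡p = acyclic⇒irreflexive G (proj₂ dag) pq (sym q≡p)
  dag₀ : DAGWithLeavesIndeg1 G₀
  dag₀ = removeArc-preserves G dag₁ pq px x≢q qy
  G₀⊆G : ∀ {a b} → Arc G₀ a b → Arc G a b
  G₀⊆G ab = removeArc-arc⁻ G p q ab
  px₀ : SoleParent G₀ p x
  px₀ = soleParent-⊆ G G₀ G₀⊆G (leaf-soleParent G leaves1 lx px)
          (removeArc-arc⁺ G p q px λ (_ , x≡q) → x≢q x≡q)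
  qy₀ : SoleParent G₀ q y
  qy₀ = soleParent-⊆ G G₀ G₀⊆G (leaf-soleParent G leaves1 ly qy)
          (removeArc-arc⁺ G p q qy λ (q≡p , _) → q≢p q≡p)
  qy₁ : SoleParent G₁ q y
  qy₁ = Suppressed-soleParent s₁ qy₀ q≢p (leaf≢tail G ly px)

-- Reduced DAGs

edgePath : Fin n × Fin n → List (Fin n)
edgePath (a , b) = a ∷ b ∷ []

module _ (G : Graph n) (dag : IsDAG G) (reduced : IsReduced G) where

  private
    arc? : (e : Fin n × Fin n) → Dec (Arc G (proj₁ e) (proj₂ e))
    arc? (a , b) = arc G a b ≟ᵇ true

    allPairs : List (Fin n × Fin n)
    allPairs = cartesianProduct (allFin n) (allFin n)

    arcList : List (Fin n × Fin n)
    arcList = filter arc? allPairs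

    arcList-arc : ∀ {a b} → (a , b) ∈ arcList → Arc G a b
    arcList-arc e∈ = proj₂ (∈-filter⁻ arc? {xs = allPairs} e∈)

    Conn-from-tail : ∀ {a b z} → Arc G a b → z ∈ edgePath (a , b) → Conn G a z
    Conn-from-tail ab (here refl)         = ε
    Conn-from-tail ab (there (here refl)) = fwd ab ◅ ε

    Conn-to-tail : ∀ {a b z} → Arc G a b → z ∈ edgePath (a , b) → Conn G z a
    Conn-to-tail ab (here refl)         = ε
    Conn-to-tail ab (there (here refl)) = bwd ab ◅ ε

  reduced-component : ∀ {a b} → Arc G a b →
                      IsLeaf G b × (∀ c d → Arc G c d → Conn G a c → c ≡ a × d ≡ b)
  reduced-component {a} {b} ab
    with _ , _ , _ , _ , _ , lb , only ← reduced a (proj₁ (proj₁ dag a b ab))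
    with refl , refl ← only a b ab ε
    = lb , only

  reduced-endpoint : ∀ {v} → V G v → ∃[ a ] ∃[ b ] Arc G a b × v ∈ edgePath (a , b)
  reduced-endpoint {v} vv with a , b , ab , v~a , _ , _ , only ← reduced v vv with v~a
  ... | ε          = a , b , ab , here refl
  ... | fwd vc ◅ _ = a , b , ab , here (proj₁ (only v _ vc ε))
  ... | bwd cv ◅ _ = a , b , ab , there (here (proj₂ (only _ v cv (bwd cv ◅ ε))))

  edgePath-leafPath : ∀ {a b} → Arc G a b → LeafPath G (edgePath (a , b))
  edgePath-leafPath {a} {b} ab = record
    { linked     = ab ∷ [-]
    ; chordless  = λ c∈ _ cd → adjacent (proj₂ (reduced-component ab) _ _ cd (Conn-from-tail ab c∈))
    ; endsAtLeaf = a ∷ [] , b , refl , proj₁ (reduced-component ab)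
    }
    where
    adjacent : ∀ {c d} → c ≡ a × d ≡ b → Adjacent (edgePath (a , b)) c d
    adjacent (refl , refl) = here

  partition-reduced : HasLeafPathPartition G
  partition-reduced = map edgePath arcList , record
    { leafPaths   = paths
    ; enumeration = record { unique = unique ; sound = sound ; complete = complete }
    }
    where
    paths : ∀ {π} → π ∈ map edgePath arcList → LeafPath G π
    paths π∈ with _ , e∈ , refl ← ∈-map⁻ edgePath π∈ = edgePath-leafPath (arcList-arc e∈)
    unique : Unique (concat (map edgePath arcList))
    unique = Unique-concat-map⁺ edgePath
      (filter⁺ arc? (cartesianProduct⁺ (allFin⁺ n) (allFin⁺ n)))
      (λ e∈ → Unique-∷⁺ (λ { (here a≡b) → acyclic⇒irreflexive G (proj₂ dag) (arcList-arc e∈) a≡b })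
                        (Unique-∷⁺ (λ ()) []))
      shared⇒≡
      where
      shared⇒≡ : ∀ {e f z} → e ∈ arcList → f ∈ arcList → z ∈ edgePath e → z ∈ edgePath f →
                 e ≡ f
      shared⇒≡ {a , b} {c , d} e∈ f∈ z∈ab z∈cd
        with refl , refl ← proj₂ (reduced-component (arcList-arc e∈)) c d (arcList-arc f∈)
                             (Conn-from-tail (arcList-arc e∈) z∈ab ◅◅ Conn-to-tail (arcList-arc f∈) z∈cd)
        = refl
    sound : ∀ {v} → v ∈ concat (map edgePath arcList) → V G v
    sound v∈
      with π , v∈π , π∈ ← ∈-concat⁻′ (map edgePath arcList) v∈
      with (a , b) , e∈ , refl ← ∈-map⁻ edgePath π∈ | v∈π
    ... | here refl         = proj₁ (proj₁ dag a b (arcList-arc e∈))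
    ... | there (here refl) = proj₂ (proj₁ dag a b (arcList-arc e∈))
    complete : ∀ {v} → V G v → v ∈ concat (map edgePath arcList)
    complete vv with a , b , ab , v∈ ← reduced-endpoint vv =
      ∈-concat⁺′ v∈ (∈-map⁺ edgePath (∈-filter⁺ arc? (∈-cartesianProduct⁺ (∈-allFin a) (∈-allFin b)) ab))

reducible⇒partition : {G G′ : Graph n} → DAGWithLeavesIndeg1 G → Star PickCherry G G′ → IsReduced G′ →
                      HasLeafPathPartition G
reducible⇒partition {G = G} dag₁ ε             reduced = partition-reduced G (proj₁ dag₁) reduced
reducible⇒partition         dag₁ (pick ◅ picks) reduced =
  partition-PickCherry⁻ dag₁ pick (reducible⇒partition (PickCherry-preserves dag₁ pick) picks reduced)

-- Leaf induced path partitions and forests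

module _ {G : Graph n} where

  LeafPath⇒IsLeafInducedPath : ∀ {π} → Unique π → LeafPath G π → IsLeafInducedPath G π
  LeafPath⇒IsLeafInducedPath {π} u path = linked path , induced , endsAtLeaf path
    where
    induced : IsInduced G π
    induced i j _ _ j≢1+i ij =
      j≢1+i (Adjacent-index π i j u (chordless path (∈-lookup i) (∈-lookup j) ij) refl refl)

  LeafPathPartition⇒IsLeafInducedPathPartition : ∀ {P} → LeafPathPartition G P → IsLeafInducedPathPartition G P
  LeafPathPartition⇒IsLeafInducedPathPartition part =
    All.tabulate (λ π∈ → LeafPath⇒IsLeafInducedPath (Unique-concat⁻ unique π∈) (leafPaths part π∈)) ,
    unique , (λ _ → sound) , (λ _ → complete)
    where open VertexEnumeration (enumeration part)

module PathForest {G : Graph n} (dag : IsDAG G) {P : List (List (Fin n))} (part : LeafPathPartition G P) where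

  open VertexEnumeration (enumeration part)

  pathArc : Fin n → Fin n → Bool
  pathArc u v = isYes (any? (λ π → adjacent? _≟_ π u v) P)

  F : Graph n
  F = spanning G pathArc

  Arc-F⁻ : ∀ {u v} → Arc F u v → ∃[ π ] π ∈ P × Adjacent π u v
  Arc-F⁻ {u} {v} uv = find (isYes⇒ (any? (λ π → adjacent? _≟_ π u v) P) uv)

  Arc-F⁺ : ∀ {π u v} → π ∈ P → Adjacent π u v → Arc F u v
  Arc-F⁺ {u = u} {v} π∈ d = ⇒isYes (any? (λ π → adjacent? _≟_ π u v) P) (lose π∈ d)

  F⊆G : ∀ u v → Arc F u v → Arc G u v
  F⊆G u v uv with π , π∈ , d ← Arc-F⁻ uv = Linked-Adjacent (linked (leafPaths part π∈)) d

  Linked-F : ∀ {π} → π ∈ P → Linked (Arc F) π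
  Linked-F π∈ = Linked⇐Adjacent (Arc-F⁺ π∈)

  Conn-F-within : ∀ {π u v} → π ∈ P → u ∈ π → Conn F u v → v ∈ π
  Conn-F-within π∈ u∈ ε = u∈
  Conn-F-within π∈ u∈ (fwd uw ◅ w~v)
    with σ , σ∈ , d ← Arc-F⁻ uw
    with refl ← Unique-concat-≡ unique σ∈ π∈ (Adjacent⇒∈ˡ d) u∈
    = Conn-F-within π∈ (Adjacent⇒∈ʳ d) w~v
  Conn-F-within π∈ u∈ (bwd wu ◅ w~v)
    with σ , σ∈ , d ← Arc-F⁻ wu
    with refl ← Unique-concat-≡ unique σ∈ π∈ (Adjacent⇒∈ʳ d) u∈
    = Conn-F-within π∈ (Adjacent⇒∈ˡ d) w~v

  head-noParent : ∀ {r rs a} → (r ∷ rs) ∈ P → ¬ Arc F a r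
  head-noParent π∈ ar
    with σ , σ∈ , d ← Arc-F⁻ ar
    with refl ← Unique-concat-≡ unique σ∈ π∈ (Adjacent⇒∈ʳ d) (here refl)
    = Adjacent-head (Unique-concat⁻ unique π∈) d

  isForest : IsForest F
  isForest = (arcs-alive , acyclic-⊆⁺ G F (λ {a} {b} ab → [ F⊆G a b ab ]) (proj₂ dag)) , indeg≱2 , root
    where
    arcs-alive : ∀ u v → Arc F u v → V F u × V F v
    arcs-alive u v uv = proj₁ dag u v (F⊆G u v uv)
    indeg≱2 : ∀ v → V F v → ¬ 2 ≤ indeg F v
    indeg≱2 v _ = atMostOne⇒count≱2 (λ u → arc F u v) sole-pred
      where
      sole-pred : ∀ a b → Arc F a v → Arc F b v → a ≡ b
      sole-pred a b av bv
        with π , π∈ , d ← Arc-F⁻ av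
        with σ , σ∈ , d′ ← Arc-F⁻ bv
        with refl ← Unique-concat-≡ unique π∈ σ∈ (Adjacent⇒∈ʳ d) (Adjacent⇒∈ʳ d′)
        = Adjacent-unique-pred (Unique-concat⁻ unique π∈) d d′
    root : ∀ v → V F v →
           Σ (Fin n) λ r → IsRoot F r × Conn F v r × (∀ r′ → IsRoot F r′ → Conn F v r′ → r′ ≡ r)
    root v vv with r ∷ rs , v∈π , π∈ ← ∈-concat⁻′ P (complete vv) =
      r , r-root , Linked-connects-head (Linked-F π∈) v∈π , only-root
      where
      r-root : IsRoot F r
      r-root = sound (∈-concat⁺′ (here refl) π∈) ,
               false⇒count≡0 (λ u → arc F u r) (λ u → ¬-not (head-noParent π∈))
      only-root : ∀ r′ → IsRoot F r′ → Conn F v r′ → r′ ≡ r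
      only-root r′ (_ , indeg0) v~r′ with Conn-F-within π∈ v∈π v~r′
      ... | here r′≡r   = r′≡r
      ... | there r′∈rs with a , d ← ∈⇒predecessor r′∈rs =
        ⊥-elim (true⇒count≢0 (λ u → arc F u r′) a (Arc-F⁺ π∈ d) indeg0)

  sameLeaves : ∀ v → (IsLeaf F v → IsLeaf G v) × (IsLeaf G v → IsLeaf F v)
  sameLeaves v = F-leaf⇒G-leaf , λ lf → noArc⇒leaf F (proj₁ lf) λ b vb → leaf⇒noArc G lf b (F⊆G v b vb)
    where
    F-leaf⇒G-leaf : IsLeaf F v → IsLeaf G v
    F-leaf⇒G-leaf lf
      with π , v∈π , π∈ ← ∈-concat⁻′ P (complete (proj₁ lf))
      with ps , l , refl , ll ← endsAtLeaf (leafPaths part π∈)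
      with refl ← Linked-sink≡last ps (Linked-F π∈) v∈π (leaf⇒noArc F lf)
      = ll

  otherArcs-joinTrees : ∀ u v → Arc G u v → ¬ Arc F u v → ¬ Conn F u v
  otherArcs-joinTrees u v uv ¬Fuv u~v
    with π , u∈π , π∈ ← ∈-concat⁻′ P (complete (proj₁ (proj₁ dag u v uv))) =
    ¬Fuv (Arc-F⁺ π∈ (chordless (leafPaths part π∈) u∈π (Conn-F-within π∈ u∈π u~v) uv))

  forestBased : IsForestBased G
  forestBased = pathArc , F⊆G , isForest , sameLeaves , otherArcs-joinTrees

reducible⇒leafInducedPathPartition : {G : Graph n} → DAGWithLeavesIndeg1 G → Reducible G →
                                     HasLeafInducedPathPartition G
reducible⇒leafInducedPathPartition dag₁ (_ , picks , reduced)
  with P , part ← reducible⇒partition dag₁ picks reduced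
  = P , LeafPathPartition⇒IsLeafInducedPathPartition part

orchard⇒forestBased : {G : Graph n} → IsOrchard G → IsForestBased G
orchard⇒forestBased ((dag , _ , _ , _ , leaves1 , _ , _) , _ , picks , reduced) =
  PathForest.forestBased dag (proj₂ (reducible⇒partition (dag , leaves1) picks reduced))

theorem5 : (∀ (n : ℕ) (G : Graph n) → IsDAG G → NoSubdivision G → LeavesIndeg1 G →
              Reducible G → HasLeafInducedPathPartition G)
            × (∀ (n : ℕ) (G : Graph n) → IsOrchard G → IsForestBased G)
theorem5 =
  (λ _ _ dag _ leaves1 → reducible⇒leafInducedPathPartition (dag , leaves1)) ,
  (λ _ _ → orchard⇒forestBased)
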